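{- Let $(L,\vee,\wedge,{\sim},{^*},0,1)$ be a regular pseudocomplemented Kleene algebra, let $\mathcal{F}_p$ be the set of its prime filters, and for $P\in\mathcal{F}_p$ let $g(P)=\{x\in L\mid {\sim}x\notin P\}$. Then $(\mathcal{F}_p,\subseteq,g)$ is a Kleene--Varlet space.
   Context: A pseudocomplemented Kleene algebra is an algebra $(L,\vee,\wedge,{\sim},{^*},0,1)$ such that $(L,\vee,\wedge,0,1)$ is a bounded distributive lattice, ${\sim}$ satisfies ${\sim}{\sim}x=x$, $x\leq y\Rightarrow {\sim}x\geq{\sim}y$, and $x\wedge{\sim}x\leq y\vee{\sim}y$, and $x^*$ is the pseudocomplement of $x$ (i.e. $x\wedge z=0$ iff $z\leq x^*$). It is regular if for all $x,y$: $x^*=y^*$ and $({\sim}x)^*=({\sim}y)^*$ imply $x=y$. A prime filter is a filter $P\neq L$ such that $a\vee b\in P$ implies $a\in P$ or $b\in P$. A Kleene--Varlet space is a triple $(X,\leq,g)$ where $(X,\leq)$ is a poset and $g\colon X\to X$ satisfies: (J1) $x\leq y$ implies $g(x)\geq g(y)$; (J2) $g(g(x))=x$; (J3) $x\leq g(x)$ or $g(x)\leq x$; (J4) every chain in $(X,\leq)$ has at most two elements. -}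

module Defs where

open import Level using (Level; suc; _⊔_)
open import Data.Product using (Σ; _×_; _,_; proj₁)
open import Data.Sum using (_⊎_)
open import Relation.Nullary using (¬_)
open import Relation.Unary using (Pred; _⊆_; _≐_)
open import Relation.Binary.Core using (Rel)
open import Relation.Binary.Structures using (IsPartialOrder)
open import Relation.Binary.PropositionalEquality using (_≡_)
open import Algebra.Lattice.Structures using (IsDistributiveLattice)

record PKleeneAlgebra (a : Level) : Set (suc a) where
  infixr 6 _∨_
  infixr 7 _∧_
  infix 8 ~_
  infix 4 _≤_
  field
    Carrier : Set a
    _∨_ _∧_ : Carrier → Carrier → Carrier
    ~_ : Carrier → Carrier
    _* : Carrier → Carrier
    𝟎 𝟏 : Carrier

  _≤_ : Carrier → Carrier → Set a
  x ≤ y = x ∧ y ≡ x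

  field
    isDistributiveLattice : IsDistributiveLattice _≡_ _∨_ _∧_
    𝟎-least    : ∀ x → 𝟎 ≤ x
    𝟏-greatest : ∀ x → x ≤ 𝟏
    ~~         : ∀ x → ~ (~ x) ≡ x
    ~-antitone : ∀ {x y} → x ≤ y → ~ y ≤ ~ x
    kleene     : ∀ x y → (x ∧ ~ x) ≤ (y ∨ ~ y)
    pseudo⇒    : ∀ x z → x ∧ z ≡ 𝟎 → z ≤ (x *)
    pseudo⇐    : ∀ x z → z ≤ (x *) → x ∧ z ≡ 𝟎

  Regular : Set a
  Regular = ∀ x y → x * ≡ y * → (~ x) * ≡ (~ y) * → x ≡ y

  record IsPrimeFilter (P : Pred Carrier a) : Set a where
    field
      has-𝟏   : P 𝟏
      up      : ∀ {x y} → x ≤ y → P x → P y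
      meet    : ∀ {x y} → P x → P y → P (x ∧ y)
      proper  : ¬ (∀ x → P x)
      prime   : ∀ {x y} → P (x ∨ y) → P x ⊎ P y

  PrimeFilter : Set (suc a)
  PrimeFilter = Σ (Pred Carrier a) IsPrimeFilter

  gPred : Pred Carrier a → Pred Carrier a
  gPred P x = ¬ P (~ x)

  _≐F_ : Rel PrimeFilter a
  P ≐F Q = proj₁ P ≐ proj₁ Q

  _⊆F_ : Rel PrimeFilter a
  P ⊆F Q = proj₁ P ⊆ proj₁ Q

record IsKleeneVarletSpace {x ℓ₁ ℓ₂ : Level} {X : Set x}
         (_≈_ : Rel X ℓ₁) (_≤_ : Rel X ℓ₂) (g : X → X) : Set (x ⊔ ℓ₁ ⊔ ℓ₂) where
  Comparable : X → X → Set ℓ₂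
  Comparable p q = p ≤ q ⊎ q ≤ p
  field
    isPartialOrder : IsPartialOrder _≈_ _≤_
    J1 : ∀ {p q} → p ≤ q → g q ≤ g p
    J2 : ∀ p → g (g p) ≈ p
    J3 : ∀ p → p ≤ g p ⊎ g p ≤ p
    -- every chain has at most two elements: any three pairwise comparable
    -- elements are not pairwise distinct
    J4 : ∀ p q r → Comparable p q → Comparable q r → Comparable p r →
         p ≈ q ⊎ q ≈ r ⊎ p ≈ r

module Submission where

-- The algebraic heart is a consequence of regularity: writing x⁺ = ~((~x)*),
-- an element a with (~a)* = 0 lies below every b with b* = 0
-- (compare a ∧ b with a via regularity).  Since x ∨ x⁺ = 1 and
-- (~(x ∧ x⁺))* = 0 = (y ∨ y*)*, this gives x ∧ x⁺ ≤ y ∨ y* for all x, y.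
-- If P ⊊ Q ⊊ R were prime filters with x ∈ Q∖P and y ∈ R∖Q, then x⁺ ∈ P,
-- so x ∧ x⁺ ∈ Q and hence y ∨ y* ∈ Q; but y ∉ Q and y* ∉ Q (as y ∈ R),
-- contradicting primality.  So chains have length at most two (J4).

open import Defs
open import Level using (Level)
open import Data.Product using (Σ; _,_; proj₁; swap)
open import Data.Sum using (_⊎_; inj₁; inj₂; [_,_])
open import Data.Empty using (⊥; ⊥-elim)
open import Function using (_∘_)
open import Relation.Nullary using (¬_; yes; no)
open import Relation.Unary using (Pred; _⊆_; _≐_)
open import Relation.Unary.Properties using (⊆-reflexive; ⊆-trans; ⊆-antisym; ≐-refl; ≐-sym; ≐-trans)
open import Relation.Binary.Core using (Rel)
open import Relation.Binary.Structures using (IsPartialOrder)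
open import Relation.Binary.PropositionalEquality using (_≡_; sym; cong; subst; module ≡-Reasoning)
import Relation.Binary.Construct.On as On
open import Algebra.Lattice.Bundles using (Lattice)
open import Algebra.Lattice.Structures using (IsDistributiveLattice)
import Algebra.Lattice.Properties.Lattice as LatticeProperties
import Relation.Binary.Lattice as OrderLattice
open import Axiom.ExcludedMiddle using (ExcludedMiddle)
open import Axiom.DoubleNegationElimination using (em⇒dne)

⊆-isPartialOrder : ∀ {a} {A : Set a} → IsPartialOrder {A = Pred A a} _≐_ _⊆_
⊆-isPartialOrder = record
  { isPreorder = record
    { isEquivalence = record { refl = ≐-refl ; sym = ≐-sym ; trans = ≐-trans }
    ; reflexive = ⊆-reflexive
    ; trans = ⊆-trans
    }
  ; antisym = ⊆-antisym
  }

-- For any relation ≤ and symmetric ≈, J4 follows once every chain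
-- p ≤ q ≤ r collapses at one of its two steps: three pairwise comparable
-- elements can always be listed in some order as such a chain.
module ThreeChains {x ℓ₁ ℓ₂} {X : Set x} (_≈_ : Rel X ℓ₁) (_≤_ : Rel X ℓ₂)
         (≈-sym : ∀ {p q} → p ≈ q → q ≈ p)
         (collapse : ∀ {p q r} → p ≤ q → q ≤ r → p ≈ q ⊎ q ≈ r) where

  Comparable : X → X → Set ℓ₂
  Comparable p q = p ≤ q ⊎ q ≤ p

  at-most-two : ∀ p q r → Comparable p q → Comparable q r → Comparable p r →
                p ≈ q ⊎ q ≈ r ⊎ p ≈ r
  at-most-two p q r (inj₁ pq) (inj₁ qr) _ with collapse pq qr
  ... | inj₁ e = inj₁ e
  ... | inj₂ e = inj₂ (inj₁ e)
  at-most-two p q r (inj₁ pq) (inj₂ rq) (inj₁ pr) with collapse pr rq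
  ... | inj₁ e = inj₂ (inj₂ e)
  ... | inj₂ e = inj₂ (inj₁ (≈-sym e))
  at-most-two p q r (inj₁ pq) (inj₂ rq) (inj₂ rp) with collapse rp pq
  ... | inj₁ e = inj₂ (inj₂ (≈-sym e))
  ... | inj₂ e = inj₁ e
  at-most-two p q r (inj₂ qp) (inj₁ qr) (inj₁ pr) with collapse qp pr
  ... | inj₁ e = inj₁ (≈-sym e)
  ... | inj₂ e = inj₂ (inj₂ e)
  at-most-two p q r (inj₂ qp) (inj₁ qr) (inj₂ rp) with collapse qr rp
  ... | inj₁ e = inj₂ (inj₁ e)
  ... | inj₂ e = inj₂ (inj₂ (≈-sym e))
  at-most-two p q r (inj₂ qp) (inj₂ rq) _ with collapse rq qp
  ... | inj₁ e = inj₂ (inj₁ (≈-sym e))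
  ... | inj₂ e = inj₁ (≈-sym e)

module PKAProperties {a : Level} (L : PKleeneAlgebra a) where
  open PKleeneAlgebra L

  -- Lattice order: the standard library's natural order is x ≡ x ∧ y,
  -- the symmetric form of our x ∧ y ≡ x.
  private
    lattice : Lattice a a
    lattice = record { isLattice = IsDistributiveLattice.isLattice isDistributiveLattice }
    module Std = OrderLattice.Lattice (LatticeProperties.∨-∧-orderTheoreticLattice lattice)

  ≤-refl : ∀ {x} → x ≤ x
  ≤-refl = sym Std.refl

  ≤-trans : ∀ {x y z} → x ≤ y → y ≤ z → x ≤ z
  ≤-trans p q = sym (Std.trans (sym p) (sym q))

  ≤-antisym : ∀ {x y} → x ≤ y → y ≤ x → x ≡ y
  ≤-antisym p q = Std.antisym (sym p) (sym q)

  x∧y≤x : ∀ x y → x ∧ y ≤ x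
  x∧y≤x x y = sym (Std.x∧y≤x x y)

  x∧y≤y : ∀ x y → x ∧ y ≤ y
  x∧y≤y x y = sym (Std.x∧y≤y x y)

  ∧-greatest : ∀ {x y z} → x ≤ y → x ≤ z → x ≤ y ∧ z
  ∧-greatest p q = sym (Std.∧-greatest (sym p) (sym q))

  x≤x∨y : ∀ x y → x ≤ x ∨ y
  x≤x∨y x y = sym (Std.x≤x∨y x y)

  y≤x∨y : ∀ x y → y ≤ x ∨ y
  y≤x∨y x y = sym (Std.y≤x∨y x y)

  ∨-least : ∀ {x y z} → x ≤ z → y ≤ z → x ∨ y ≤ z
  ∨-least p q = sym (Std.∨-least (sym p) (sym q))

  ≤𝟎⇒≡𝟎 : ∀ {x} → x ≤ 𝟎 → x ≡ 𝟎
  ≤𝟎⇒≡𝟎 p = ≤-antisym p (𝟎-least _)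

  ~-swapˡ : ∀ {x y} → ~ x ≤ y → ~ y ≤ x
  ~-swapˡ {x} {y} p = subst (~ y ≤_) (~~ x) (~-antitone p)

  ~-swapʳ : ∀ {x y} → x ≤ ~ y → y ≤ ~ x
  ~-swapʳ {x} {y} p = subst (_≤ ~ x) (~~ y) (~-antitone p)

  𝟏≤~𝟎 : 𝟏 ≤ ~ 𝟎
  𝟏≤~𝟎 = ~-swapʳ (𝟎-least (~ 𝟏))

  ~𝟏≤𝟎 : ~ 𝟏 ≤ 𝟎
  ~𝟏≤𝟎 = ~-swapˡ (𝟏-greatest (~ 𝟎))

  ~-∧ : ∀ x y → ~ (x ∧ y) ≤ ~ x ∨ ~ y
  ~-∧ x y = ~-swapˡ (∧-greatest (~-swapˡ (x≤x∨y (~ x) (~ y))) (~-swapˡ (y≤x∨y (~ x) (~ y))))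

  ~-∨ : ∀ x y → ~ x ∧ ~ y ≤ ~ (x ∨ y)
  ~-∨ x y = ~-swapʳ (∨-least (~-swapʳ (x∧y≤x (~ x) (~ y))) (~-swapʳ (x∧y≤y (~ x) (~ y))))

  x∧x*≡𝟎 : ∀ x → x ∧ (x *) ≡ 𝟎
  x∧x*≡𝟎 x = pseudo⇐ x (x *) ≤-refl

  *-antitone : ∀ {x y} → x ≤ y → y * ≤ x *
  *-antitone {x} {y} x≤y = pseudo⇒ x (y *) (begin
      x ∧ (y *)        ≡⟨ cong (_∧ (y *)) (sym x≤y) ⟩
      (x ∧ y) ∧ (y *)  ≡⟨ ∧-assoc x y (y *) ⟩
      x ∧ (y ∧ (y *))  ≡⟨ cong (x ∧_) (x∧x*≡𝟎 y) ⟩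
      x ∧ 𝟎            ≡⟨ ∧-comm x 𝟎 ⟩
      𝟎 ∧ x            ≡⟨ 𝟎-least x ⟩
      𝟎                ∎)
    where
    open ≡-Reasoning
    open IsDistributiveLattice isDistributiveLattice using (∧-assoc; ∧-comm)

  Dense : Carrier → Set a
  Dense t = t * ≤ 𝟎

  dense-above : ∀ {s t} → s ≤ t → s * ≤ t → Dense t
  dense-above {s} {t} s≤t s*≤t =
    subst (t * ≤_) (x∧x*≡𝟎 (s *)) (∧-greatest (*-antitone s≤t) (*-antitone s*≤t))

  y∨y*-dense : ∀ y → Dense (y ∨ y *)
  y∨y*-dense y = dense-above (x≤x∨y y (y *)) (y≤x∨y y (y *))

  infix 9 _⁺
  _⁺ : Carrier → Carrier
  x ⁺ = ~ ((~ x) *)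

  ~x⁺≡[~x]* : ∀ x → ~ (x ⁺) ≡ (~ x) *
  ~x⁺≡[~x]* x = ~~ ((~ x) *)

  x∨x⁺-top : ∀ x → 𝟏 ≤ x ∨ x ⁺
  x∨x⁺-top x = ≤-trans 𝟏≤~𝟎 (~-swapˡ ~[x∨x⁺]≤𝟎)
    where
    ~[x∨x⁺]≤𝟎 : ~ (x ∨ x ⁺) ≤ 𝟎
    ~[x∨x⁺]≤𝟎 = subst (~ (x ∨ x ⁺) ≤_) (x∧x*≡𝟎 (~ x))
      (subst (λ w → ~ (x ∨ x ⁺) ≤ ~ x ∧ w) (~x⁺≡[~x]* x)
        (∧-greatest (~-antitone (x≤x∨y x (x ⁺))) (~-antitone (y≤x∨y x (x ⁺)))))

  ~[x∧x⁺]-dense : ∀ x → Dense (~ (x ∧ x ⁺))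
  ~[x∧x⁺]-dense x = dense-above (~-antitone (x∧y≤x x (x ⁺)))
    (subst (_≤ ~ (x ∧ x ⁺)) (~x⁺≡[~x]* x) (~-antitone (x∧y≤y x (x ⁺))))

  -- In a regular algebra, an element with dense negation lies below every
  -- dense element: a ∧ b and a have the same pseudocomplement and the same
  -- pseudocomplement of the negation, so they coincide.
  regular-≤ : Regular → ∀ {a b} → Dense (~ a) → Dense b → a ≤ b
  regular-≤ regular {a} {b} ~a-dense b-dense = regular (a ∧ b) a same-* same-~*
    where
    open IsDistributiveLattice isDistributiveLattice using (∧-assoc; ∧-comm)
    c = a ∧ b

    b∧[a∧c*]≡𝟎 : b ∧ (a ∧ c *) ≡ 𝟎
    b∧[a∧c*]≡𝟎 = begin
      b ∧ (a ∧ c *)  ≡⟨ sym (∧-assoc b a (c *)) ⟩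
      (b ∧ a) ∧ c *  ≡⟨ cong (_∧ c *) (∧-comm b a) ⟩
      c ∧ c *        ≡⟨ x∧x*≡𝟎 c ⟩
      𝟎              ∎
      where open ≡-Reasoning

    a∧c*≡𝟎 : a ∧ c * ≡ 𝟎
    a∧c*≡𝟎 = ≤𝟎⇒≡𝟎 (≤-trans (pseudo⇒ b (a ∧ c *) b∧[a∧c*]≡𝟎) b-dense)

    same-* : c * ≡ a *
    same-* = ≤-antisym (pseudo⇒ a (c *) a∧c*≡𝟎) (*-antitone (x∧y≤x a b))

    same-~* : (~ c) * ≡ (~ a) *
    same-~* = ≤-antisym (*-antitone (~-antitone (x∧y≤x a b))) (≤-trans ~a-dense (𝟎-least _))

  x∧x⁺≤y∨y* : Regular → ∀ x y → x ∧ x ⁺ ≤ y ∨ y *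
  x∧x⁺≤y∨y* regular x y = regular-≤ regular (~[x∧x⁺]-dense x) (y∨y*-dense y)

  module PrimeFilterFacts {P : Pred Carrier a} (isPF : IsPrimeFilter P) where
    open IsPrimeFilter isPF

    𝟎∉ : ¬ P 𝟎
    𝟎∉ 𝟎∈ = proper (λ z → up (𝟎-least z) 𝟎∈)

    join-∉ : ∀ {x y} → ¬ P x → ¬ P y → ¬ P (x ∨ y)
    join-∉ x∉ y∉ = [ x∉ , y∉ ] ∘ prime

    *-∉ : ∀ {x} → P x → ¬ P (x *)
    *-∉ {x} x∈ x*∈ = 𝟎∉ (subst P (x∧x*≡𝟎 x) (meet x∈ x*∈))

    -- Since x ∨ x⁺ = 𝟏, a prime filter missing x contains x⁺.
    ⁺-∈ : ∀ {x} → ¬ P x → P (x ⁺)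
    ⁺-∈ {x} x∉ with prime (up (x∨x⁺-top x) has-𝟏)
    ... | inj₁ x∈  = ⊥-elim (x∉ x∈)
    ... | inj₂ x⁺∈ = x⁺∈

  no-strict-chain : Regular → ∀ {P Q R} → IsPrimeFilter P → IsPrimeFilter Q → IsPrimeFilter R →
    P ⊆ Q → Q ⊆ R → ∀ {x y} → Q x → ¬ P x → R y → ¬ Q y → ⊥
  no-strict-chain regular {Q = Q} isP isQ isR P⊆Q Q⊆R {x} {y} x∈Q x∉P y∈R y∉Q =
    PrimeFilterFacts.join-∉ isQ y∉Q y*∉Q y∨y*∈Q
    where
    y*∉Q : ¬ Q (y *)
    y*∉Q = PrimeFilterFacts.*-∉ isR y∈R ∘ Q⊆R

    x∧x⁺∈Q : Q (x ∧ x ⁺)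
    x∧x⁺∈Q = IsPrimeFilter.meet isQ x∈Q (P⊆Q (PrimeFilterFacts.⁺-∈ isP x∉P))

    y∨y*∈Q : Q (y ∨ y *)
    y∨y*∈Q = IsPrimeFilter.up isQ (x∧x⁺≤y∨y* regular x y) x∧x⁺∈Q

module PrimeFilterSpace {a : Level} (em : ExcludedMiddle a) (L : PKleeneAlgebra a) where
  open PKleeneAlgebra L
  open PKAProperties L

  private
    dne : ∀ {A : Set a} → ¬ ¬ A → A
    dne = em⇒dne em

  -- ~(x ∨ y) ∉ P forces ~x ∉ P or ~y ∉ P, since otherwise their meet,
  -- which lies below ~(x ∨ y), would be in P.
  g-isPrimeFilter : ∀ P → IsPrimeFilter P → IsPrimeFilter (gPred P)
  g-isPrimeFilter P isP = record
    { has-𝟏  = 𝟎∉ ∘ up ~𝟏≤𝟎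
    ; up     = λ x≤y ~x∉ ~y∈ → ~x∉ (up (~-antitone x≤y) ~y∈)
    ; meet   = λ ~x∉ ~y∉ → join-∉ ~x∉ ~y∉ ∘ up (~-∧ _ _)
    ; proper = λ everything → everything 𝟎 (up 𝟏≤~𝟎 has-𝟏)
    ; prime  = g-prime
    }
    where
    open IsPrimeFilter isP
    open PrimeFilterFacts isP

    g-prime : ∀ {x y} → ¬ P (~ (x ∨ y)) → ¬ P (~ x) ⊎ ¬ P (~ y)
    g-prime {x} {y} ~x∨y∉ with em {P (~ x)} | em {P (~ y)}
    ... | no ~x∉  | _        = inj₁ ~x∉
    ... | yes _   | no ~y∉   = inj₂ ~y∉
    ... | yes ~x∈ | yes ~y∈  = ⊥-elim (~x∨y∉ (up (~-∨ x y) (meet ~x∈ ~y∈)))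

  g : PrimeFilter → PrimeFilter
  g (P , isP) = gPred P , g-isPrimeFilter P isP

  -- J2: x ∈ g(g(P)) says ¬¬ P (~~x), which classically is P x.
  g-involutive : ∀ P → g (g P) ≐F P
  g-involutive (P , _) = (λ {x} ¬¬~~x∈ → subst P (~~ x) (dne ¬¬~~x∈))
                       , (λ {x} x∈ ~~x∉ → ~~x∉ (subst P (sym (~~ x)) x∈))

  -- J3: if P ⊈ g(P) then some x, ~x ∈ P; by the Kleene condition every
  -- y ∨ ~y is then in P, so any y ∈ g(P) (i.e. ~y ∉ P) is in P.
  g-comparable : ∀ P → P ⊆F g P ⊎ g P ⊆F P
  g-comparable (P , isP) with em {P ⊆ gPred P}
  ... | yes P⊆gP = inj₁ P⊆gP
  ... | no  P⊈gP = inj₂ (λ {y} ~y∉ → dne λ y∉ → P⊈gP λ {x} x∈ ~x∈ →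
                    join-∉ y∉ ~y∉ (up (kleene x y) (meet x∈ ~x∈)))
    where
    open IsPrimeFilter isP
    open PrimeFilterFacts isP

  chain-collapses : Regular → ∀ {P Q R} → P ⊆F Q → Q ⊆F R → P ≐F Q ⊎ Q ≐F R
  chain-collapses regular {P , isP} {Q , isQ} {R , isR} P⊆Q Q⊆R with em {Q ⊆ P}
  ... | yes Q⊆P = inj₁ (P⊆Q , Q⊆P)
  ... | no  Q⊈P = inj₂ (Q⊆R , λ y∈R → dne λ y∉Q → Q⊈P λ x∈Q → dne λ x∉P →
                    no-strict-chain regular isP isQ isR P⊆Q Q⊆R x∈Q x∉P y∈R y∉Q)

  kleeneVarletSpace : Regular → IsKleeneVarletSpace _≐F_ _⊆F_ g
  kleeneVarletSpace regular = record
    { isPartialOrder = On.isPartialOrder proj₁ ⊆-isPartialOrder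
    ; J1 = λ P⊆Q ~x∉Q ~x∈P → ~x∉Q (P⊆Q ~x∈P)
    ; J2 = g-involutive
    ; J3 = g-comparable
    ; J4 = ThreeChains.at-most-two _≐F_ _⊆F_ swap
               (λ {P} {Q} {R} → chain-collapses regular {P} {Q} {R})
    }

lemma3p5 : {a : Level} → ExcludedMiddle a → (L : PKleeneAlgebra a) →
    PKleeneAlgebra.Regular L →
    Σ (∀ P → PKleeneAlgebra.IsPrimeFilter L P → PKleeneAlgebra.IsPrimeFilter L (PKleeneAlgebra.gPred L P))
      (λ gPF → IsKleeneVarletSpace (PKleeneAlgebra._≐F_ L) (PKleeneAlgebra._⊆F_ L)
                 (λ { (P , hP) → PKleeneAlgebra.gPred L P , gPF P hP }))
lemma3p5 em L regular = g-isPrimeFilter , kleeneVarletSpace regular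
  where open PrimeFilterSpace em L
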